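{- Let $w\in\{0,1,2\}^*$ be a word with $|w|\ge4$ such that $10w01$ is square-free. Then every $v\in h(0w0)$ is nice.
   Context: $h$ maps letters to sets of words: $h(0)=\{012102120210201021201210,\ 0121021202102012021201210\}$, $h(1)=\{120210201021012102012021,\ 1202102010210120102012021\}$, $h(2)=\{201021012102120210120102,\ 2010210121021201210120102\}$; for a word $w=w_1\ldots w_m$, $h(w)$ is the set of words $v_1\ldots v_m$ with $v_j\in h(w_j)$. A word $s_1\ldots s_{2m}$ ($m\ge1$) is a square if $s_i=s_{i+m}$ for all $i\le m$; a word is square-free if no factor of it is a square. $\overline w$ is the mirror image of $w$. Let $q=1202120121021201021$, $\overline{q}=1201021201210212021$, $p=\overline{q}\,0\,q$. A word $v$ is nice if $p\,v\,p$ is square-free and contains exactly two occurrences of $q$ and exactly two occurrences of $\overline q$. -}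

module Defs where

open import Data.List using (List; []; _∷_; _++_; reverse; length)
open import Data.Nat using (ℕ; zero; suc; _≤_; _+_)
open import Data.Bool using (Bool; true; false; _∧_; if_then_else_)
open import Data.Product using (∃; _×_; _,_)
open import Relation.Nullary using (¬_)
open import Relation.Binary.PropositionalEquality using (_≡_; _≢_)

data Letter : Set where
  c0 c1 c2 : Letter

Word : Set
Word = List Letter

mirror : Word → Word
mirror = reverse

-- h(a) is a set of two words for each letter a; HLetter a u means u ∈ h(a)
data HLetter : Letter → Word → Set where
  h0a : HLetter c0 (c0 ∷ c1 ∷ c2 ∷ c1 ∷ c0 ∷ c2 ∷ c1 ∷ c2 ∷ c0 ∷ c2 ∷ c1 ∷ c0 ∷ c2 ∷ c0 ∷ c1 ∷ c0 ∷ c2 ∷ c1 ∷ c2 ∷ c0 ∷ c1 ∷ c2 ∷ c1 ∷ c0 ∷ [])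
  h0b : HLetter c0 (c0 ∷ c1 ∷ c2 ∷ c1 ∷ c0 ∷ c2 ∷ c1 ∷ c2 ∷ c0 ∷ c2 ∷ c1 ∷ c0 ∷ c2 ∷ c0 ∷ c1 ∷ c2 ∷ c0 ∷ c2 ∷ c1 ∷ c2 ∷ c0 ∷ c1 ∷ c2 ∷ c1 ∷ c0 ∷ [])
  h1a : HLetter c1 (c1 ∷ c2 ∷ c0 ∷ c2 ∷ c1 ∷ c0 ∷ c2 ∷ c0 ∷ c1 ∷ c0 ∷ c2 ∷ c1 ∷ c0 ∷ c1 ∷ c2 ∷ c1 ∷ c0 ∷ c2 ∷ c0 ∷ c1 ∷ c2 ∷ c0 ∷ c2 ∷ c1 ∷ [])
  h1b : HLetter c1 (c1 ∷ c2 ∷ c0 ∷ c2 ∷ c1 ∷ c0 ∷ c2 ∷ c0 ∷ c1 ∷ c0 ∷ c2 ∷ c1 ∷ c0 ∷ c1 ∷ c2 ∷ c0 ∷ c1 ∷ c0 ∷ c2 ∷ c0 ∷ c1 ∷ c2 ∷ c0 ∷ c2 ∷ c1 ∷ [])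
  h2a : HLetter c2 (c2 ∷ c0 ∷ c1 ∷ c0 ∷ c2 ∷ c1 ∷ c0 ∷ c1 ∷ c2 ∷ c1 ∷ c0 ∷ c2 ∷ c1 ∷ c2 ∷ c0 ∷ c2 ∷ c1 ∷ c0 ∷ c1 ∷ c2 ∷ c0 ∷ c1 ∷ c0 ∷ c2 ∷ [])
  h2b : HLetter c2 (c2 ∷ c0 ∷ c1 ∷ c0 ∷ c2 ∷ c1 ∷ c0 ∷ c1 ∷ c2 ∷ c1 ∷ c0 ∷ c2 ∷ c1 ∷ c2 ∷ c0 ∷ c1 ∷ c2 ∷ c1 ∷ c0 ∷ c1 ∷ c2 ∷ c0 ∷ c1 ∷ c0 ∷ c2 ∷ [])

-- InH w v means v ∈ h(w): v = v₁…vₘ with vⱼ ∈ h(wⱼ)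
data InH : Word → Word → Set where
  []  : InH [] []
  _∷_ : ∀ {a u w v} → HLetter a u → InH w v → InH (a ∷ w) (u ++ v)

IsSquare : Word → Set
IsSquare s = ∃ λ u → (u ≢ []) × (s ≡ u ++ u)

HasSquareFactor : Word → Set
HasSquareFactor w = ∃ λ x → ∃ λ s → ∃ λ y → (w ≡ x ++ s ++ y) × IsSquare s

SquareFree : Word → Set
SquareFree w = ¬ HasSquareFactor w

_=?_ : Letter → Letter → Bool
c0 =? c0 = true
c1 =? c1 = true
c2 =? c2 = true
_  =? _  = false

isPrefix : Word → Word → Bool
isPrefix []       _        = true
isPrefix (_ ∷ _)  []       = false
isPrefix (a ∷ u)  (b ∷ w)  = (a =? b) ∧ isPrefix u w

-- occurrences u w : number of positions i such that u occurs in w starting at i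
-- (for nonempty u; occurrences may overlap)
occurrences : Word → Word → ℕ
occurrences u []       = 0
occurrences u (b ∷ w)  = (if isPrefix u (b ∷ w) then 1 else 0) + occurrences u w

q : Word
q = (c1 ∷ c2 ∷ c0 ∷ c2 ∷ c1 ∷ c2 ∷ c0 ∷ c1 ∷ c2 ∷ c1 ∷ c0 ∷ c2 ∷ c1 ∷ c2 ∷ c0 ∷ c1 ∷ c0 ∷ c2 ∷ c1 ∷ [])

qbar : Word
qbar = mirror q

p : Word
p = qbar ++ c0 ∷ q

Nice : Word → Set
Nice v = SquareFree (p ++ v ++ p)
       × (occurrences q (p ++ v ++ p) ≡ 2)
       × (occurrences qbar (p ++ v ++ p) ≡ 2)

-- Write p v p as the concatenation of the blocks p, h(a₁), …, h(aₘ), p, where a₁…aₘ = 0w0, and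
-- give p the letter 1: the letter word is then 10w01, square-free by hypothesis, and p is
-- adjacent only to blocks of letter 0. The seven blocks form a prefix code, no block occurs in
-- another at a positive offset, and the first 19 letters of a block occur in two consecutive
-- blocks only at a block boundary. Let uu be a square starting in the suffix r of a block. If
-- |u| < |r| + 19, then uu lies within five consecutive blocks, and an exhaustive search over such
-- windows rules it out. Otherwise the second u begins with the first 19 letters of a block, so it
-- begins at a block boundary; stripping the blocks the two copies of u have in common then
-- exposes a square in the letter word. Finally, only p contains q and q̄, once each, and no
-- occurrence of them straddles two blocks.

module Submission where

open import Defs
open import Data.Bool using (Bool; true; false; _∧_; _∨_; not; T; if_then_else_)
open import Data.Bool.ListAction using (all)
open import Data.Bool.Properties using (T-∧; T-∨; T-≡)
open import Data.Empty using (⊥; ⊥-elim)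
open import Data.Fin using (Fin)
import Data.Fin.Properties as Fin
open import Data.List using (List; []; _∷_; _++_; _∷ʳ_; length; map; take; drop; concatMap; downFrom; lookup)
open import Data.List.Properties
  using (∷-injectiveʳ; ∷ʳ-injectiveʳ; ∷ʳ-++; ++-assoc; ++-identityʳ; ++-identityʳ-unique; ++-identityˡ-unique;
         ++-cancelˡ; ++-cancelʳ; ++-conicalˡ; ++-conicalʳ; length-++; length-++-≤ʳ; length-take; map-++;
         concatMap-++; take++drop≡id; drop-drop; ++-monoid; ∷-injective)
open import Data.List.Membership.Propositional using (_∈_)
open import Data.List.Membership.Propositional.Properties using (∈-downFrom⁺; ∈-downFrom⁻)
open import Data.List.Relation.Unary.All as All using (All)
open import Data.List.Relation.Unary.All.Properties using (all⁺; all⁻)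
open import Data.List.Relation.Unary.Any using (here; there; index)
open import Data.List.Relation.Unary.Any.Properties using (lookup-index)
open import Data.List.Relation.Unary.Linked as Linked using (Linked; [-]; linked?)
open import Data.Nat using (ℕ; zero; suc; _+_; _*_; _≤_; _<_; _≤ᵇ_; _≡ᵇ_; z≤n; s≤s; _≤?_; _<?_)
open import Data.Nat.Properties
  using (≤-reflexive; ≤-trans; ≤-pred; <⇒≤; ≰⇒>; ≮⇒≥; <-irrefl; m+1+n≰m; m≤m+n; m≤n+m; m⊓n≤m;
         m≤n⇒m⊓n≡m; +-comm; +-assoc; +-suc; +-mono-≤; +-monoˡ-≤; +-monoʳ-≤; +-cancelˡ-≤; ≤ᵇ⇒≤; ≡ᵇ⇒≡;
         module ≤-Reasoning)
open import Data.Product using (∃; ∃₂; _×_; _,_; proj₁; proj₂)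
open import Data.Sum as Sum using (_⊎_; inj₁; inj₂; [_,_])
open import Data.Unit using (⊤; tt)
open import Function using (_∘_; case_of_; Equivalence)
open import Relation.Binary.Definitions using (DecidableEquality)
open import Relation.Binary.PropositionalEquality using (_≡_; _≢_; refl; sym; trans; cong; cong₂; subst; module ≡-Reasoning)
open import Relation.Nullary using (¬_; yes; no)
open import Relation.Nullary.Decidable using (⌊_⌋; map′; toWitness; fromWitness; T?)
open import Tactic.MonoidSolver using (solve)

module _ {A : Set} where

  levi : (a b c d : List A) → a ++ b ≡ c ++ d →
         (∃ λ e → c ≡ a ++ e × b ≡ e ++ d) ⊎ (∃ λ e → e ≢ [] × a ≡ c ++ e × d ≡ e ++ b)
  levi []      b c       d eq = inj₁ (c , refl , eq)
  levi (x ∷ a) b []      d eq = inj₂ (x ∷ a , (λ ()) , refl , sym eq)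
  levi (x ∷ a) b (y ∷ c) d eq with ∷-injective eq
  ... | refl , eq′ with levi a b c d eq′
  ...   | inj₁ (e , c≡ , b≡)        = inj₁ (e , cong (x ∷_) c≡ , b≡)
  ...   | inj₂ (e , e≢[] , a≡ , d≡) = inj₂ (e , e≢[] , cong (x ∷_) a≡ , d≡)

  levi-≤ : (a b c d : List A) → a ++ b ≡ c ++ d → length a ≤ length c →
           ∃ λ e → c ≡ a ++ e × b ≡ e ++ d
  levi-≤ a b c d eq a≤c with levi a b c d eq
  ... | inj₁ split                      = split
  ... | inj₂ ([]    , e≢[] , _    , _)   = ⊥-elim (e≢[] refl)
  ... | inj₂ (_ ∷ _ , _    , refl , _)   = ⊥-elim (m+1+n≰m (length c) (subst (_≤ length c) (length-++ c) a≤c))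

  take-length-++ : ∀ (u y : List A) → take (length u) (u ++ y) ≡ u
  take-length-++ []      y = refl
  take-length-++ (a ∷ u) y = cong (a ∷_) (take-length-++ u y)

  drop-length-++ : ∀ (u y : List A) → drop (length u) (u ++ y) ≡ y
  drop-length-++ []      y = refl
  drop-length-++ (a ∷ u) y = drop-length-++ u y

  length-<-++ : ∀ {w} (s x : List A) → w ≡ s ++ x → x ≢ [] → length s < length w
  length-<-++ []      []      _    x≢[] = ⊥-elim (x≢[] refl)
  length-<-++ []      (_ ∷ _) refl _    = s≤s z≤n
  length-<-++ (a ∷ s) x       refl x≢[] = s≤s (length-<-++ s x refl x≢[])

module _ {A : Set} {R : A → A → Set} where

  linked-++⁻ˡ : ∀ xs {ys} → Linked R (xs ++ ys) → Linked R xs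
  linked-++⁻ˡ []           _       = Linked.[]
  linked-++⁻ˡ (x ∷ [])     _       = [-]
  linked-++⁻ˡ (x ∷ y ∷ xs) (r Linked.∷ l) = r Linked.∷ linked-++⁻ˡ (y ∷ xs) l

  linked-++⁻ʳ : ∀ xs {ys} → Linked R (xs ++ ys) → Linked R ys
  linked-++⁻ʳ []       l = l
  linked-++⁻ʳ (x ∷ xs) l = linked-++⁻ʳ xs (Linked.tail l)

≡true⇒T : ∀ {x} → x ≡ true → T x
≡true⇒T = Equivalence.from T-≡

T⇒≡true : ∀ {x} → T x → x ≡ true
T⇒≡true = Equivalence.to T-≡

T-∧⁻ : ∀ {x y} → T (x ∧ y) → T x × T y
T-∧⁻ = Equivalence.to T-∧

T-∧⁺ : ∀ {x y} → T x → T y → T (x ∧ y)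
T-∧⁺ tx ty = Equivalence.from T-∧ (tx , ty)

T-∨⁻ : ∀ {x y} → T (x ∨ y) → T x ⊎ T y
T-∨⁻ = Equivalence.to T-∨

T-∨⁺ : ∀ {x y} → T x ⊎ T y → T (x ∨ y)
T-∨⁺ = Equivalence.from T-∨

T-not : ∀ {x} → T (not x) → ¬ T x
T-not {true} ()

¬T⇒T-not : ∀ {x} → ¬ T x → T (not x)
¬T⇒T-not {false} _  = tt
¬T⇒T-not {true}  ¬t = ⊥-elim (¬t tt)

_⇒ᵇ_ : Bool → Bool → Bool
x ⇒ᵇ y = not x ∨ y

⇒ᵇ-sound : ∀ {x y} → T (x ⇒ᵇ y) → T x → T y
⇒ᵇ-sound {true} h _ = h

allBelow : ℕ → (ℕ → Bool) → Bool
allBelow n f = all f (downFrom n)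

allBelow-sound : ∀ n f → T (allBelow n f) → ∀ {i} → i < n → T (f i)
allBelow-sound n f h i<n = All.lookup (all⁺ f (downFrom n) h) (∈-downFrom⁺ i<n)

allBelow-complete : ∀ n f → (∀ {i} → i < n → T (f i)) → T (allBelow n f)
allBelow-complete n f h = all⁻ f (All.tabulate (h ∘ ∈-downFrom⁻))

square-∷ : ∀ {a x} → HasSquareFactor x → HasSquareFactor (a ∷ x)
square-∷ {a} (x′ , s , y′ , refl , sq) = a ∷ x′ , s , y′ , refl , sq

square-infix : ∀ x {s} y → HasSquareFactor s → HasSquareFactor (x ++ s ++ y)
square-infix x y (x′ , s , y′ , refl , sq) = x ++ x′ , s , y′ ++ y , solve (++-monoid Letter) , sq

SquareFree-infix : ∀ x {s} y → SquareFree (x ++ s ++ y) → SquareFree s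
SquareFree-infix x y sf = sf ∘ square-infix x y

square-map : ∀ {B : Set} (f : B → Letter) (pre X Y post : List B) → X ≢ [] → map f X ≡ map f Y →
             HasSquareFactor (map f (pre ++ X ++ Y ++ post))
square-map f pre []          Y post X≢[] _     = ⊥-elim (X≢[] refl)
square-map f pre X@(_ ∷ _) Y post _    fX≡fY =
  map f pre , map f X ++ map f X , map f post , eq , map f X , (λ ()) , refl
  where
  eq : map f (pre ++ X ++ Y ++ post) ≡ map f pre ++ (map f X ++ map f X) ++ map f post
  eq = begin
    map f (pre ++ X ++ Y ++ post)                   ≡⟨ map-++ f pre _ ⟩
    map f pre ++ map f (X ++ Y ++ post)             ≡⟨ cong (map f pre ++_) (map-++ f X _) ⟩
    map f pre ++ map f X ++ map f (Y ++ post)       ≡⟨ cong (λ z → map f pre ++ map f X ++ z) (map-++ f Y post) ⟩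
    map f pre ++ map f X ++ map f Y ++ map f post   ≡⟨ cong (λ z → map f pre ++ map f X ++ z ++ map f post) fX≡fY ⟨
    map f pre ++ map f X ++ map f X ++ map f post   ≡⟨ cong (map f pre ++_) (++-assoc (map f X) _ _) ⟨
    map f pre ++ (map f X ++ map f X) ++ map f post ∎
    where open ≡-Reasoning

-- Concatenations of code words

module Concatenation {A C : Set} (code : A → List C) where

  data SuffixPosition (Bs : List A) (S : List C) : Set where
    atEnd   : S ≡ [] → SuffixPosition Bs S
    inBlock : ∀ Pre B Ds r₀ r → Bs ≡ Pre ++ B ∷ Ds → code B ≡ r₀ ++ r → r ≢ [] →
              S ≡ r ++ concatMap code Ds → SuffixPosition Bs S

  suffixPosition : ∀ Bs X S → concatMap code Bs ≡ X ++ S → SuffixPosition Bs S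
  suffixPosition []       X S e = atEnd (++-conicalʳ X S (sym e))
  suffixPosition (B ∷ Bs) X S e with levi (code B) (concatMap code Bs) X S e
  ... | inj₁ (X′ , _ , e′)            = shift (suffixPosition Bs X′ S e′)
    where
    shift : SuffixPosition Bs S → SuffixPosition (B ∷ Bs) S
    shift (atEnd S≡[])                       = atEnd S≡[]
    shift (inBlock Pre B′ Ds r₀ r eq c r≢[] eS) = inBlock (B ∷ Pre) B′ Ds r₀ r (cong (B ∷_) eq) c r≢[] eS
  ... | inj₂ (r , r≢[] , codeB≡ , eS) = inBlock [] B Bs X r refl codeB≡ r≢[] eS

  Nonempty : Set
  Nonempty = ∀ a → code a ≢ []

  PrefixFree : Set
  PrefixFree = ∀ a b z → code b ≡ code a ++ z → a ≡ b

  concatMap≡[] : Nonempty → ∀ Es → concatMap code Es ≡ [] → Es ≡ []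
  concatMap≡[] nonempty []      _ = refl
  concatMap≡[] nonempty (E ∷ _) e = ⊥-elim (nonempty E (++-conicalˡ (code E) _ e))

  suffix-of-suffix : Nonempty → ∀ Pre Ds Pre′ Ds′ z → Pre ++ Ds ≡ Pre′ ++ Ds′ →
                     concatMap code Ds ≡ z ++ concatMap code Ds′ →
                     ∃ λ M → Ds ≡ M ++ Ds′ × concatMap code M ≡ z
  suffix-of-suffix nonempty Pre Ds Pre′ Ds′ z eq eDs with levi Pre Ds Pre′ Ds′ eq
  ... | inj₁ (M , _ , refl) =
    M , refl , ++-cancelʳ (concatMap code Ds′) (concatMap code M) z (trans (sym (concatMap-++ code M Ds′)) eDs)
  ... | inj₂ (E , E≢[] , _ , refl) = ⊥-elim (E≢[] (concatMap≡[] nonempty E (++-conicalʳ z _ z++E≡[])))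
    where
    z++E≡[] : z ++ concatMap code E ≡ []
    z++E≡[] = ++-identityˡ-unique (z ++ concatMap code E)
      (trans eDs (trans (cong (z ++_) (concatMap-++ code E Ds)) (sym (++-assoc z _ _))))

  HeadLonger : List C → List A → Set
  HeadLonger t []      = ⊤
  HeadLonger t (a ∷ _) = length t < length (code a)

  record CommonPrefix (Ds Ds′ : List A) (R R′ : List C) : Set where
    field
      Es Fs Fs′ : List A
      t         : List C
      Ds≡       : Ds ≡ Es ++ Fs
      Ds′≡      : Ds′ ≡ Es ++ Fs′
      Fs≡       : concatMap code Fs ≡ t ++ R
      Fs′≡      : concatMap code Fs′ ≡ t ++ R′
      headLonger : HeadLonger t Fs

  record Realignment (Ds : List A) (z Y : List C) : Set where
    field
      Es Mid Fs′ : List A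
      t          : List C
      Ds≡        : Ds ≡ Es ++ Mid ++ Es ++ Fs′
      Mid≡       : concatMap code Mid ≡ t ++ z
      Fs′≡       : concatMap code Fs′ ≡ t ++ Y
      headLonger : HeadLonger t Mid

  module _ (nonempty : Nonempty) (prefixFree : PrefixFree) where

    same-first-block : ∀ a b x y → code a ++ x ≡ code b ++ y → a ≡ b
    same-first-block a b x y e with levi (code a) x (code b) y e
    ... | inj₁ (z , codeB≡ , _)    = prefixFree a b z codeB≡
    ... | inj₂ (z , _ , codeA≡ , _) = sym (prefixFree b a z codeA≡)

    stripCommonPrefix : ∀ Ds Ds′ v R R′ → concatMap code Ds ≡ v ++ R → concatMap code Ds′ ≡ v ++ R′ →
                        CommonPrefix Ds Ds′ R R′
    stripCommonPrefix [] Ds′ v R R′ eDs eDs′ = record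
      { Es = [] ; Fs = [] ; Fs′ = Ds′ ; t = v ; Ds≡ = refl ; Ds′≡ = refl
      ; Fs≡ = eDs ; Fs′≡ = eDs′ ; headLonger = tt }
    stripCommonPrefix (a ∷ Ds) Ds′ v R R′ eDs eDs′ with length (code a) ≤? length v
    ... | no a>v = record
      { Es = [] ; Fs = a ∷ Ds ; Fs′ = Ds′ ; t = v ; Ds≡ = refl ; Ds′≡ = refl
      ; Fs≡ = eDs ; Fs′≡ = eDs′ ; headLonger = ≰⇒> a>v }
    ... | yes a≤v with levi-≤ (code a) (concatMap code Ds) v R eDs a≤v
    ...   | v′ , refl , eDs-rest with Ds′
    ...     | [] = ⊥-elim (nonempty a (++-conicalˡ (code a) _ (++-conicalˡ (code a ++ v′) R′ (sym eDs′))))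
    ...     | b ∷ Ds″ with same-first-block a b (v′ ++ R′) (concatMap code Ds″)
                                              (trans (sym (++-assoc (code a) v′ R′)) (sym eDs′))
    ...       | refl with stripCommonPrefix Ds Ds″ v′ R R′ eDs-rest
                            (++-cancelˡ (code a) _ _ (trans eDs′ (++-assoc (code a) v′ R′)))
    ...         | rest = record
      { Es = a ∷ Es ; Fs = Fs ; Fs′ = Fs′ ; t = t ; Ds≡ = cong (a ∷_) Ds≡ ; Ds′≡ = cong (a ∷_) Ds′≡
      ; Fs≡ = Fs≡ ; Fs′≡ = Fs′≡ ; headLonger = headLonger }
      where open CommonPrefix rest

    -- If Ds′, a suffix of the same sequence as Ds, starts with v and Ds starts with v ++ z ++ Ds′,
    -- the prefix code makes both parsings of v begin with the same blocks Es.
    realign : ∀ Pre Ds Pre′ Ds′ v z Y → Pre ++ Ds ≡ Pre′ ++ Ds′ →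
              concatMap code Ds ≡ v ++ z ++ concatMap code Ds′ → concatMap code Ds′ ≡ v ++ Y →
              Realignment Ds z Y
    realign Pre Ds Pre′ Ds′ v z Y eq eDs eDs′
      with suffix-of-suffix nonempty Pre Ds Pre′ Ds′ (v ++ z) eq (trans eDs (sym (++-assoc v z _)))
    ... | M , refl , eM = record
      { Es = Es ; Mid = Fs ; Fs′ = Fs′ ; t = t
      ; Ds≡ = trans (cong (_++ Ds′) Ds≡) (trans (cong ((Es ++ Fs) ++_) Ds′≡) (solve (++-monoid A)))
      ; Mid≡ = Fs≡ ; Fs′≡ = Fs′≡ ; headLonger = headLonger }
      where open CommonPrefix (stripCommonPrefix M Ds′ v z Y eM eDs′)

=?⇒≡ : ∀ {a b} → T (a =? b) → a ≡ b
=?⇒≡ {c0} {c0} _ = refl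
=?⇒≡ {c1} {c1} _ = refl
=?⇒≡ {c2} {c2} _ = refl
=?⇒≡ {c0} {c1} ()
=?⇒≡ {c0} {c2} ()
=?⇒≡ {c1} {c0} ()
=?⇒≡ {c1} {c2} ()
=?⇒≡ {c2} {c0} ()
=?⇒≡ {c2} {c1} ()

=?-refl : ∀ a → T (a =? a)
=?-refl c0 = tt
=?-refl c1 = tt
=?-refl c2 = tt

isPrefix-++ : ∀ u z → T (isPrefix u (u ++ z))
isPrefix-++ []       z = tt
isPrefix-++ (c0 ∷ u) z = isPrefix-++ u z
isPrefix-++ (c1 ∷ u) z = isPrefix-++ u z
isPrefix-++ (c2 ∷ u) z = isPrefix-++ u z

isPrefix⇒++ : ∀ u w → T (isPrefix u w) → ∃ λ z → w ≡ u ++ z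
isPrefix⇒++ []      w       _ = w , refl
isPrefix⇒++ (a ∷ u) []      ()
isPrefix⇒++ (a ∷ u) (b ∷ w) h with T-∧⁻ {a =? b} h
... | a=b , rest with =?⇒≡ {a} a=b | isPrefix⇒++ u w rest
...   | refl | z , refl = z , refl

isPrefix-++-≤ : ∀ u x y → length u ≤ length x → isPrefix u (x ++ y) ≡ isPrefix u x
isPrefix-++-≤ []      x       y _         = refl
isPrefix-++-≤ (a ∷ u) (b ∷ x) y (s≤s u≤x) = cong ((a =? b) ∧_) (isPrefix-++-≤ u x y u≤x)

squarePrefixᵇ : ℕ → Word → Bool
squarePrefixᵇ n x = isPrefix (take n x) (drop n x)

squarePrefixᵇ-sound : ∀ m a x → T (squarePrefixᵇ (suc m) (a ∷ x)) → HasSquareFactor (a ∷ x)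
squarePrefixᵇ-sound m a x h with isPrefix⇒++ (take (suc m) (a ∷ x)) (drop (suc m) (a ∷ x)) h
... | z , e = [] , u ++ u , z , a∷x≡ , u , (λ ()) , refl
  where
  u = take (suc m) (a ∷ x)
  a∷x≡ : a ∷ x ≡ (u ++ u) ++ z
  a∷x≡ = trans (sym (take++drop≡id (suc m) (a ∷ x))) (trans (cong (u ++_) e) (sym (++-assoc u u z)))

squareFreeᵇ : Word → Bool
squareFreeᵇ []      = true
squareFreeᵇ (a ∷ x) = allBelow (suc (length x)) (λ m → not (squarePrefixᵇ (suc m) (a ∷ x))) ∧ squareFreeᵇ x

squareFreeᵇ-complete : ∀ x → SquareFree x → T (squareFreeᵇ x)
squareFreeᵇ-complete []      _  = tt
squareFreeᵇ-complete (a ∷ x) sf =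
  T-∧⁺ (allBelow-complete (suc (length x)) (λ m → not (squarePrefixᵇ (suc m) (a ∷ x)))
                          λ {m} _ → ¬T⇒T-not (sf ∘ squarePrefixᵇ-sound m a x))
       (squareFreeᵇ-complete x (sf ∘ square-∷))

onlyAtStartᵇ : ℕ → Word → Word → Bool
onlyAtStartᵇ n x y = allBelow n λ o → isPrefix x (drop o y) ⇒ᵇ (o ≡ᵇ 0)

onlyAtStartᵇ-sound : ∀ n x y → T (onlyAtStartᵇ n x y) → ∀ s z → y ≡ s ++ x ++ z → length s < n → s ≡ []
onlyAtStartᵇ-sound n x y h []        z _    _   = refl
onlyAtStartᵇ-sound n x y h s@(_ ∷ _) z refl s<n = ⊥-elim (⇒ᵇ-sound (allBelow-sound n _ h s<n) x-at-s)
  where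
  x-at-s : T (isPrefix x (drop (length s) (s ++ x ++ z)))
  x-at-s = subst (T ∘ isPrefix x) (sym (drop-length-++ s (x ++ z))) (isPrefix-++ x z)

_≡ʷ_ : Word → Word → Bool
[]      ≡ʷ []      = true
(a ∷ x) ≡ʷ (b ∷ y) = (a =? b) ∧ (x ≡ʷ y)
_       ≡ʷ _       = false

≡ʷ-refl : ∀ x → T (x ≡ʷ x)
≡ʷ-refl []       = tt
≡ʷ-refl (c0 ∷ x) = ≡ʷ-refl x
≡ʷ-refl (c1 ∷ x) = ≡ʷ-refl x
≡ʷ-refl (c2 ∷ x) = ≡ʷ-refl x

-- x ≡ t ++ r and y ≡ t ++ e with e ≢ [], for some t
properStemᵇ : Word → Word → Word → Bool
properStemᵇ r (a ∷ x) (b ∷ y) = ((a ∷ x) ≡ʷ r) ∨ ((a =? b) ∧ properStemᵇ r x y)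
properStemᵇ r []      (_ ∷ _) = [] ≡ʷ r
properStemᵇ r _       []      = false

properStemᵇ-complete : ∀ t r e → e ≢ [] → T (properStemᵇ r (t ++ r) (t ++ e))
properStemᵇ-complete t       r       []      e≢[] = ⊥-elim (e≢[] refl)
properStemᵇ-complete []      []      (_ ∷ _) _    = tt
properStemᵇ-complete []      (a ∷ r) (_ ∷ _) _    = T-∨⁺ (inj₁ (≡ʷ-refl (a ∷ r)))
properStemᵇ-complete (a ∷ t) r       e@(_ ∷ _) e≢[] =
  T-∨⁺ (inj₂ (T-∧⁺ (=?-refl a) (properStemᵇ-complete t r e e≢[])))

data Block : Set where
  hBlock : ∀ {a u} → HLetter a u → Block
  pBlock : Block

word : Block → Word
word (hBlock {u = u} _) = u
word pBlock             = p

letter : Block → Letter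
letter (hBlock {a = a} _) = a
letter pBlock             = c1

flatten : List Block → Word
flatten = concatMap word

open Concatenation word

blocks : List Block
blocks = hBlock h0a ∷ hBlock h0b ∷ hBlock h1a ∷ hBlock h1b ∷ hBlock h2a ∷ hBlock h2b ∷ pBlock ∷ []

∈-blocks : ∀ b → b ∈ blocks
∈-blocks (hBlock h0a) = here refl
∈-blocks (hBlock h0b) = there (here refl)
∈-blocks (hBlock h1a) = there (there (here refl))
∈-blocks (hBlock h1b) = there (there (there (here refl)))
∈-blocks (hBlock h2a) = there (there (there (there (here refl))))
∈-blocks (hBlock h2b) = there (there (there (there (there (here refl)))))
∈-blocks pBlock       = there (there (there (there (there (there (here refl))))))

blockIndex : Block → Fin (length blocks)
blockIndex = index ∘ ∈-blocks

blockIndex-injective : ∀ {a b} → blockIndex a ≡ blockIndex b → a ≡ b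
blockIndex-injective {a} {b} e =
  trans (lookup-index (∈-blocks a)) (trans (cong (lookup blocks) e) (sym (lookup-index (∈-blocks b))))

_≟_ : DecidableEquality Block
a ≟ b = map′ blockIndex-injective (cong blockIndex) (blockIndex a Fin.≟ blockIndex b)

allBlocks : (Block → Bool) → Bool
allBlocks f = all f blocks

-- Checked facts are stated as b ≡ true and proved by refl: elaborating a proof of T b against
-- T b would normalise b with the much slower conversion checker.
allBlocks-sound : ∀ (f : Block → Bool) → allBlocks f ≡ true → ∀ b → T (f b)
allBlocks-sound f h b = All.lookup (all⁺ f blocks (≡true⇒T h)) (∈-blocks b)

allBlocks²-sound : ∀ (f : Block → Block → Bool) → allBlocks (λ a → allBlocks (f a)) ≡ true → ∀ a b → T (f a b)
allBlocks²-sound f h a = allBlocks-sound (f a) (T⇒≡true (allBlocks-sound (λ a → allBlocks (f a)) h a))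

allBlocks³-sound : ∀ (f : Block → Block → Block → Bool) →
                   allBlocks (λ a → allBlocks λ b → allBlocks (f a b)) ≡ true → ∀ a b c → T (f a b c)
allBlocks³-sound f h a = allBlocks²-sound (f a) (T⇒≡true (allBlocks-sound (λ a → allBlocks λ b → allBlocks (f a b)) h a))

24≤length-word : ∀ b → 24 ≤ length (word b)
24≤length-word = ≤ᵇ⇒≤ 24 _ ∘ allBlocks-sound (λ b → 24 ≤ᵇ length (word b)) refl

length-word≤39 : ∀ b → length (word b) ≤ 39
length-word≤39 = ≤ᵇ⇒≤ _ 39 ∘ allBlocks-sound (λ b → length (word b) ≤ᵇ 39) refl

word≢[] : Nonempty
word≢[] b e = case (subst (λ w → 24 ≤ length w) e (24≤length-word b)) of λ ()

word-prefixFree : PrefixFree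
word-prefixFree a b z e =
  toWitness (⇒ᵇ-sound (allBlocks²-sound prefixFreeᵇ refl a b) (subst (T ∘ isPrefix (word a)) (sym e) (isPrefix-++ (word a) z)))
  where
  prefixFreeᵇ : Block → Block → Bool
  prefixFreeᵇ a b = isPrefix (word a) (word b) ⇒ᵇ ⌊ a ≟ b ⌋

block-not-interior : ∀ B X s z → word B ≡ s ++ word X ++ z → s ≡ []
block-not-interior B X s z e =
  onlyAtStartᵇ-sound (length (word B)) (word X) (word B) (allBlocks²-sound interiorᵇ refl B X) s z e s<B
  where
  interiorᵇ : Block → Block → Bool
  interiorᵇ B X = onlyAtStartᵇ (length (word B)) (word X) (word B)
  s<B : length s < length (word B)
  s<B = length-<-++ s (word X ++ z) e (word≢[] X ∘ ++-conicalˡ (word X) z)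

prefix19 : Block → Word
prefix19 b = take 19 (word b)

length-prefix19 : ∀ b → length (prefix19 b) ≡ 19
length-prefix19 b = trans (length-take 19 (word b)) (m≤n⇒m⊓n≡m (≤-trans (≤ᵇ⇒≤ 19 24 tt) (24≤length-word b)))

prefix19-at-boundary : ∀ B B′ Y s z → word B ++ word B′ ≡ s ++ prefix19 Y ++ z → length s < length (word B) → s ≡ []
prefix19-at-boundary B B′ Y =
  onlyAtStartᵇ-sound (length (word B)) (prefix19 Y) (word B ++ word B′) (allBlocks³-sound syncᵇ refl B B′ Y)
  where
  syncᵇ : Block → Block → Block → Bool
  syncᵇ B B′ Y = onlyAtStartᵇ (length (word B)) (prefix19 Y) (word B ++ word B′)

stem-letters : ∀ B a b r₀ r t e → word B ≡ r₀ ++ r → r ≢ [] → word a ≡ t ++ r → word b ≡ t ++ e → e ≢ [] →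
               letter B ≡ letter a ⊎ letter b ≡ letter a
stem-letters B a b r₀ r t e eB r≢[] ea eb e≢[] =
  Sum.map =?⇒≡ =?⇒≡
    (T-∨⁻ (⇒ᵇ-sound (allBelow-sound _ _ (allBlocks³-sound stemᵇ refl B a b) (length-<-++ r₀ r eB r≢[])) stem))
  where
  stemᵇ : Block → Block → Block → Bool
  stemᵇ B a b = allBelow (length (word B)) λ k →
    properStemᵇ (drop k (word B)) (word a) (word b) ⇒ᵇ ((letter B =? letter a) ∨ (letter b =? letter a))
  stem : T (properStemᵇ (drop (length r₀) (word B)) (word a) (word b))
  stem rewrite eB | drop-length-++ r₀ r | ea | eb = properStemᵇ-complete t r e e≢[]

-- Admissible block sequences and short squares

adjacentᵇ : Block → Block → Bool
adjacentᵇ pBlock           b          = letter b =? c0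
adjacentᵇ (hBlock {a} _)   pBlock     = a =? c0
adjacentᵇ (hBlock _)       (hBlock _) = true

Adjacent : Block → Block → Set
Adjacent a b = T (adjacentᵇ a b)

Admissible : List Block → Set
Admissible Bs = SquareFree (map letter Bs) × Linked Adjacent Bs

Admissible-infix : ∀ xs ys zs → Admissible (xs ++ ys ++ zs) → Admissible ys
Admissible-infix xs ys zs (sf , linked) =
  SquareFree-infix (map letter xs) (map letter zs) (subst SquareFree map-letter-++ sf) ,
  linked-++⁻ˡ ys (linked-++⁻ʳ xs linked)
  where
  map-letter-++ : map letter (xs ++ ys ++ zs) ≡ map letter xs ++ map letter ys ++ map letter zs
  map-letter-++ = trans (map-++ letter xs _) (cong (map letter xs ++_) (map-++ letter ys zs))

admissibleᵇ : List Block → Bool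
admissibleᵇ Bs = squareFreeᵇ (map letter Bs) ∧ ⌊ linked? (λ a b → T? (adjacentᵇ a b)) Bs ⌋

admissibleᵇ-complete : ∀ Bs → Admissible Bs → T (admissibleᵇ Bs)
admissibleᵇ-complete Bs (sf , linked) = T-∧⁺ (squareFreeᵇ-complete _ sf) (fromWitness linked)

-- No square of half-length n starts at any of the first k positions of xs, where ys = drop n xs;
-- walking both lists in step keeps the evaluation of the window check below linear.
noSquaresᵇ : ℕ → ℕ → Word → Word → Bool
noSquaresᵇ n zero    _        _        = true
noSquaresᵇ n (suc k) (a ∷ xs) (b ∷ ys) = not (isPrefix (take n (a ∷ xs)) (b ∷ ys)) ∧ noSquaresᵇ n k xs ys
noSquaresᵇ n (suc k) _        _        = true

noSquaresᵇ-sound : ∀ u {w z} k xs ys i → T (noSquaresᵇ (length u) k xs ys) → i < k →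
                   drop i xs ≡ u ++ w → drop i ys ≡ u ++ z → u ≢ [] → ⊥
noSquaresᵇ-sound []      _       _        _        _       _ _         _    _    u≢[] = u≢[] refl
noSquaresᵇ-sound (c ∷ u) zero    _        _        _       _ ()        _    _    _
noSquaresᵇ-sound (c ∷ u) (suc k) []       _        zero    _ _         ()   _    _
noSquaresᵇ-sound (c ∷ u) (suc k) []       _        (suc i) _ _         ()   _    _
noSquaresᵇ-sound (c ∷ u) (suc k) (_ ∷ _)  []       zero    _ _         _    ()   _
noSquaresᵇ-sound (c ∷ u) (suc k) (_ ∷ _)  []       (suc i) _ _         _    ()   _
noSquaresᵇ-sound (c ∷ u) {w} {z} (suc k) (_ ∷ _) (_ ∷ _) zero h _ refl refl _ =
  T-not (proj₁ (T-∧⁻ h)) (subst (λ t → T (isPrefix t (c ∷ u ++ z))) (sym (take-length-++ (c ∷ u) w)) (isPrefix-++ (c ∷ u) z))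
noSquaresᵇ-sound u       (suc k) (_ ∷ xs) (_ ∷ ys) (suc i) h (s≤s i<k) exs  eys  u≢[] =
  noSquaresᵇ-sound u k xs ys i (proj₂ (T-∧⁻ h)) i<k exs eys u≢[]

shortSquareFreeᵇ : List Block → Bool
shortSquareFreeᵇ []       = true
shortSquareFreeᵇ (B ∷ Bs) = allBelow 57 λ m →
  noSquaresᵇ (suc m) (length (word B)) (flatten (B ∷ Bs)) (drop (suc m) (flatten (B ∷ Bs)))

windowsᵇ : ℕ → List Block → Bool
windowsᵇ zero    ws = shortSquareFreeᵇ ws
windowsᵇ (suc n) ws = shortSquareFreeᵇ ws ∧ allBlocks λ b → admissibleᵇ (ws ∷ʳ b) ⇒ᵇ windowsᵇ n (ws ∷ʳ b)

windowsᵇ-sound : ∀ n ws ext → windowsᵇ n ws ≡ true → length ext ≤ n → Admissible (ws ++ ext) →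
                 T (shortSquareFreeᵇ (ws ++ ext))
windowsᵇ-sound zero    ws []        h _ _ = subst (T ∘ shortSquareFreeᵇ) (sym (++-identityʳ ws)) (≡true⇒T h)
windowsᵇ-sound (suc n) ws []        h _ _ =
  subst (T ∘ shortSquareFreeᵇ) (sym (++-identityʳ ws)) (proj₁ (T-∧⁻ {shortSquareFreeᵇ ws} (≡true⇒T h)))
windowsᵇ-sound (suc n) ws (b ∷ ext) h (s≤s ext≤n) adm =
  subst (T ∘ shortSquareFreeᵇ) (++-assoc ws (b ∷ []) ext) (windowsᵇ-sound n (ws ∷ʳ b) ext extended ext≤n adm′)
  where
  adm′ : Admissible ((ws ∷ʳ b) ++ ext)
  adm′ = subst Admissible (sym (++-assoc ws (b ∷ []) ext)) adm
  extended : windowsᵇ n (ws ∷ʳ b) ≡ true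
  extended = T⇒≡true (⇒ᵇ-sound (allBlocks-sound (λ b → admissibleᵇ (ws ∷ʳ b) ⇒ᵇ windowsᵇ n (ws ∷ʳ b))
                                                (T⇒≡true (proj₂ (T-∧⁻ {shortSquareFreeᵇ ws} (≡true⇒T h)))) b)
                               (admissibleᵇ-complete _ (Admissible-infix [] (ws ∷ʳ b) ext adm′)))

window-check : windowsᵇ 5 [] ≡ true
window-check = refl

shortSquareFreeᵇ-sound : ∀ B Bs → T (shortSquareFreeᵇ (B ∷ Bs)) → ∀ s u z → flatten (B ∷ Bs) ≡ s ++ u ++ u ++ z →
                         length s < length (word B) → u ≢ [] → length u ≤ 57 → ⊥
shortSquareFreeᵇ-sound B Bs h s []      z e _   u≢[] _          = u≢[] refl
shortSquareFreeᵇ-sound B Bs h s (c ∷ u) z e s<B _    (s≤s u≤56) =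
  noSquaresᵇ-sound (c ∷ u) (length (word B)) x (drop n x) (length s)
    (allBelow-sound 57 (λ m → noSquaresᵇ (suc m) (length (word B)) x (drop (suc m) x)) h (s≤s u≤56))
    s<B at-s at-s+n (λ ())
  where
  x = flatten (B ∷ Bs)
  n = length (c ∷ u)
  at-s : drop (length s) x ≡ (c ∷ u) ++ (c ∷ u) ++ z
  at-s = trans (cong (drop (length s)) e) (drop-length-++ s _)
  at-s+n : drop (length s) (drop n x) ≡ (c ∷ u) ++ z
  at-s+n = begin
    drop (length s) (drop n x)       ≡⟨ drop-drop n (length s) x ⟩
    drop (n + length s) x            ≡⟨ cong (λ k → drop k x) (+-comm n (length s)) ⟩
    drop (length s + n) x            ≡⟨ drop-drop (length s) n x ⟨
    drop n (drop (length s) x)       ≡⟨ cong (drop n) at-s ⟩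
    drop n ((c ∷ u) ++ (c ∷ u) ++ z) ≡⟨ drop-length-++ (c ∷ u) _ ⟩
    (c ∷ u) ++ z                     ∎
    where open ≡-Reasoning

flatten-take : ∀ n Ds → drop n Ds ≡ [] ⊎ n * 24 ≤ length (flatten (take n Ds))
flatten-take zero    Ds       = inj₂ z≤n
flatten-take (suc n) []       = inj₁ refl
flatten-take (suc n) (D ∷ Ds) with flatten-take n Ds
... | inj₁ dropped = inj₁ dropped
... | inj₂ long    = inj₂ (≤-trans (+-mono-≤ (24≤length-word D) long) (≤-reflexive (sym (length-++ (word D)))))

prefix-within-take : ∀ n r Ds v Y → r ++ flatten Ds ≡ v ++ Y → length v ≤ length r + n * 24 →
                     ∃ λ E → r ++ flatten (take n Ds) ≡ v ++ E
prefix-within-take n r Ds v Y e v≤ with flatten-take n Ds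
... | inj₁ dropped = Y , trans (cong (r ++_) (sym all-taken)) e
  where
  all-taken : flatten Ds ≡ flatten (take n Ds)
  all-taken = begin
    flatten Ds                              ≡⟨ cong flatten (take++drop≡id n Ds) ⟨
    flatten (take n Ds ++ drop n Ds)        ≡⟨ cong (λ d → flatten (take n Ds ++ d)) dropped ⟩
    flatten (take n Ds ++ [])               ≡⟨ cong flatten (++-identityʳ (take n Ds)) ⟩
    flatten (take n Ds)                     ∎
    where open ≡-Reasoning
... | inj₂ long with levi-≤ v Y (r ++ flatten (take n Ds)) (flatten (drop n Ds)) split v≤window
  where
  split : v ++ Y ≡ (r ++ flatten (take n Ds)) ++ flatten (drop n Ds)
  split = begin
    v ++ Y                                                ≡⟨ e ⟨
    r ++ flatten Ds                                       ≡⟨ cong (λ d → r ++ flatten d) (take++drop≡id n Ds) ⟨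
    r ++ flatten (take n Ds ++ drop n Ds)                 ≡⟨ cong (r ++_) (concatMap-++ word (take n Ds) (drop n Ds)) ⟩
    r ++ flatten (take n Ds) ++ flatten (drop n Ds)       ≡⟨ ++-assoc r _ _ ⟨
    (r ++ flatten (take n Ds)) ++ flatten (drop n Ds)     ∎
    where open ≡-Reasoning
  v≤window : length v ≤ length (r ++ flatten (take n Ds))
  v≤window = ≤-trans v≤ (≤-trans (+-monoʳ-≤ (length r) long) (≤-reflexive (sym (length-++ r))))
... | E , eE , _ = E , eE

-- A square uu starting in the suffix r of a block with |u| < |r| + 19 has |u| ≤ 39 + 18 and lies
-- within that block and the next four, which have at least 24 letters each.
short-square-bounds : ∀ (r u : Word) → length r ≤ 39 → length u < length r + 19 →
                      length u ≤ 57 × length (u ++ u) ≤ length r + 4 * 24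
short-square-bounds r u r≤39 short = u≤57 , uu≤
  where
  u≤r+18 : length u ≤ length r + 18
  u≤r+18 = ≤-pred (subst (suc (length u) ≤_) (+-suc (length r) 18) short)
  u≤57 : length u ≤ 57
  u≤57 = ≤-trans u≤r+18 (+-monoˡ-≤ 18 r≤39)
  uu≤ : length (u ++ u) ≤ length r + 4 * 24
  uu≤ = begin
    length (u ++ u)           ≡⟨ length-++ u ⟩
    length u + length u       ≤⟨ +-mono-≤ u≤r+18 u≤57 ⟩
    (length r + 18) + 57      ≡⟨ +-assoc (length r) 18 57 ⟩
    length r + 75             ≤⟨ +-monoʳ-≤ (length r) (≤ᵇ⇒≤ 75 96 tt) ⟩
    length r + 96             ∎
    where open ≤-Reasoning

no-short-square : ∀ {Bs Pre B Ds r₀ r u Y} → Admissible Bs → Bs ≡ Pre ++ B ∷ Ds → word B ≡ r₀ ++ r → r ≢ [] →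
                r ++ flatten Ds ≡ u ++ u ++ Y → u ≢ [] → length u < length r + 19 → ⊥
no-short-square {Pre = Pre} {B} {Ds} {r₀} {r} {u} {Y} adm refl eB r≢[] eS u≢[] short =
  shortSquareFreeᵇ-sound B window window-ok r₀ u E inWindow (length-<-++ r₀ r eB r≢[]) u≢[] (proj₁ bounds)
  where
  window = take 4 Ds
  r≤39 : length r ≤ 39
  r≤39 = ≤-trans (≤-trans (m≤n+m (length r) (length r₀)) (≤-reflexive (sym (trans (cong length eB) (length-++ r₀)))))
                 (length-word≤39 B)
  bounds = short-square-bounds r u r≤39 short
  found = prefix-within-take 4 r Ds (u ++ u) Y (trans eS (sym (++-assoc u u Y))) (proj₂ bounds)
  E = proj₁ found
  window-ok : T (shortSquareFreeᵇ (B ∷ window))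
  window-ok = windowsᵇ-sound 5 [] (B ∷ window) window-check (s≤s (subst (_≤ 4) (sym (length-take 4 Ds)) (m⊓n≤m 4 _)))
    (Admissible-infix Pre (B ∷ window) (drop 4 Ds) (subst (λ d → Admissible (Pre ++ B ∷ d)) (sym (take++drop≡id 4 Ds)) adm))
  inWindow : flatten (B ∷ window) ≡ r₀ ++ u ++ u ++ E
  inWindow = begin
    word B ++ flatten window    ≡⟨ cong (_++ flatten window) eB ⟩
    (r₀ ++ r) ++ flatten window ≡⟨ ++-assoc r₀ r _ ⟩
    r₀ ++ r ++ flatten window   ≡⟨ cong (r₀ ++_) (trans (proj₂ found) (++-assoc u u E)) ⟩
    r₀ ++ u ++ u ++ E           ∎
    where open ≡-Reasoning

-- Long squares

prefix19≢[] : ∀ D → prefix19 D ≢ []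
prefix19≢[] D e = case trans (sym (length-prefix19 D)) (cong length e) of λ ()

prefix19-within-two : ∀ r Ds D Z → r ++ flatten Ds ≡ prefix19 D ++ Z → ∃₂ λ Y′ z → r ++ word Y′ ≡ prefix19 D ++ z
prefix19-within-two r []        D Z e = D , Z ++ word D , (begin
  r ++ word D            ≡⟨ cong (_++ word D) (++-identityʳ r) ⟨
  (r ++ []) ++ word D    ≡⟨ cong (_++ word D) e ⟩
  (prefix19 D ++ Z) ++ word D ≡⟨ ++-assoc (prefix19 D) Z (word D) ⟩
  prefix19 D ++ Z ++ word D ∎)
  where open ≡-Reasoning
prefix19-within-two r (Y′ ∷ Ds) D Z e
  with levi-≤ (prefix19 D) Z (r ++ word Y′) (flatten Ds) (trans (sym e) (sym (++-assoc r _ _))) 19≤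
  where
  19≤ : length (prefix19 D) ≤ length (r ++ word Y′)
  19≤ = ≤-trans (≤-reflexive (length-prefix19 D))
          (≤-trans (≤-trans (≤ᵇ⇒≤ 19 24 tt) (24≤length-word Y′))
                   (≤-trans (m≤n+m _ (length r)) (≤-reflexive (sym (length-++ r)))))
... | z , ez , _ = Y′ , z , ez

synchronize : ∀ Bs X D Z → flatten Bs ≡ X ++ prefix19 D ++ Z →
              ∃₂ λ Pre Ds → Bs ≡ Pre ++ Ds × prefix19 D ++ Z ≡ flatten Ds
synchronize Bs X D Z e with suffixPosition Bs X (prefix19 D ++ Z) e
... | atEnd e′ = ⊥-elim (prefix19≢[] D (++-conicalˡ _ Z e′))
... | inBlock Pre B Ds r₀ r eB eBr r≢[] eS with prefix19-within-two r Ds D Z (sym eS)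
...   | Y′ , z , ez = Pre , B ∷ Ds , eB , trans eS (cong (_++ flatten Ds) (sym wordB≡r))
  where
  r₀≡[] : r₀ ≡ []
  r₀≡[] = prefix19-at-boundary B Y′ D r₀ z (trans (cong (_++ word Y′) eBr) (trans (++-assoc r₀ r _) (cong (r₀ ++_) ez)))
                               (length-<-++ r₀ r eBr r≢[])
  wordB≡r : word B ≡ r
  wordB≡r = trans eBr (cong (_++ r) r₀≡[])

first-letters-differ : ∀ Pre B Es a Fs → SquareFree (map letter (Pre ++ B ∷ Es ++ a ∷ Es ++ Fs)) → letter B ≢ letter a
first-letters-differ Pre B Es a Fs sf e = sf (square-map letter Pre (B ∷ Es) (a ∷ Es) Fs (λ ()) (cong (_∷ map letter Es) e))

last-letters-differ : ∀ Pre B Es a b Fs → SquareFree (map letter (Pre ++ B ∷ Es ++ a ∷ Es ++ b ∷ Fs)) → letter b ≢ letter a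
last-letters-differ Pre B Es a b Fs sf e =
  sf (subst (HasSquareFactor ∘ map letter) rearranged
            (square-map letter (Pre ∷ʳ B) (Es ∷ʳ a) (Es ∷ʳ b) Fs ∷ʳ≢[] same-letters))
  where
  rearranged : (Pre ∷ʳ B) ++ (Es ∷ʳ a) ++ (Es ∷ʳ b) ++ Fs ≡ Pre ++ B ∷ Es ++ a ∷ Es ++ b ∷ Fs
  rearranged = trans (∷ʳ-++ Pre B _)
                     (cong (λ z → Pre ++ B ∷ z) (trans (∷ʳ-++ Es a _) (cong (λ z → Es ++ a ∷ z) (∷ʳ-++ Es b Fs))))
  ∷ʳ≢[] : Es ∷ʳ a ≢ []
  ∷ʳ≢[] e = case ++-conicalʳ Es (a ∷ []) e of λ ()
  same-letters : map letter (Es ∷ʳ a) ≡ map letter (Es ∷ʳ b)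
  same-letters = trans (map-++ letter Es (a ∷ []))
                       (trans (cong (λ c → map letter Es ++ c ∷ []) (sym e)) (sym (map-++ letter Es (b ∷ []))))

-- The configuration left by a long square: B and a end in the same r, and the blocks Es repeat.
no-shifted-repeat : ∀ {Pre B Es a r₀ r t Y} Fs′ → SquareFree (map letter (Pre ++ B ∷ Es ++ a ∷ Es ++ Fs′)) →
         word B ≡ r₀ ++ r → r ≢ [] → word a ≡ t ++ r → flatten Fs′ ≡ t ++ Y → ⊥
no-shifted-repeat {Pre} {B} {Es} {a} {r₀} {r} {t} {Y} [] sf eB r≢[] ea e =
  first-letters-differ Pre B Es a [] sf (cong letter (sym (word-prefixFree a B [] wordB≡a)))
  where
  a≡r : word a ≡ r
  a≡r = trans ea (cong (_++ r) (++-conicalˡ t Y (sym e)))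
  r₀≡[] : r₀ ≡ []
  r₀≡[] = block-not-interior B a r₀ [] (trans eB (cong (r₀ ++_) (trans (sym a≡r) (sym (++-identityʳ (word a))))))
  wordB≡a : word B ≡ word a ++ []
  wordB≡a = trans eB (trans (cong (_++ r) r₀≡[]) (trans (sym a≡r) (sym (++-identityʳ (word a)))))
no-shifted-repeat {Pre} {B} {Es} {a} {r₀} {r} {t} {Y} (b ∷ Fs) sf eB r≢[] ea e with levi (word b) (flatten Fs) t Y e
... | inj₁ (E , t≡ , _) =
  r≢[] (++-conicalʳ E r (++-identityʳ-unique (word a) (subst (λ c → word a ≡ word c ++ E ++ r) b≡a a≡b++)))
  where
  a≡b++ : word a ≡ word b ++ E ++ r
  a≡b++ = trans ea (trans (cong (_++ r) t≡) (++-assoc (word b) E r))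
  b≡a : b ≡ a
  b≡a = word-prefixFree b a (E ++ r) a≡b++
... | inj₂ (E , E≢[] , b≡ , _) =
  [ first-letters-differ Pre B Es a (b ∷ Fs) sf , last-letters-differ Pre B Es a b Fs sf ]
  (stem-letters B a b r₀ r t E eB r≢[] ea b≡ E≢[])

no-realignment : ∀ {Pre B Ds r₀ r Y} → SquareFree (map letter (Pre ++ B ∷ Ds)) → word B ≡ r₀ ++ r → r ≢ [] →
                Realignment Ds r Y → ⊥
no-realignment sf eB r≢[] record { Mid = [] ; t = t ; Mid≡ = Mid≡ } = r≢[] (++-conicalʳ t _ (sym Mid≡))
no-realignment {Pre} {B} {r₀ = r₀} {r} sf eB r≢[]
  record { Es = Es ; Mid = a ∷ Mid₁ ; Fs′ = Fs′ ; t = t ; Ds≡ = refl ; Mid≡ = Mid≡ ; Fs′≡ = Fs′≡ ; headLonger = t<a }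
  with levi-≤ t r (word a) (flatten Mid₁) (sym Mid≡) (<⇒≤ t<a)
... | r₁ , a≡ , r≡ with Mid₁
...   | [] = no-shifted-repeat Fs′ sf eB r≢[] (trans a≡ (cong (t ++_) (trans (sym (++-identityʳ r₁)) (sym r≡)))) Fs′≡
...   | X₁ ∷ M₂ = r₁≢[] (++-conicalʳ r₀ r₁ (block-not-interior B X₁ (r₀ ++ r₁) (flatten M₂) interior))
  where
  r₁≢[] : r₁ ≢ []
  r₁≢[] refl = <-irrefl refl (subst (length t <_) (trans (cong length a≡) (cong length (++-identityʳ t))) t<a)
  interior : word B ≡ (r₀ ++ r₁) ++ word X₁ ++ flatten M₂
  interior = trans eB (trans (cong (r₀ ++_) r≡) (sym (++-assoc r₀ r₁ _)))

no-long-square : ∀ {Bs X Pre B Ds r₀ r u Y} → Admissible Bs → flatten Bs ≡ X ++ u ++ u ++ Y → Bs ≡ Pre ++ B ∷ Ds →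
               word B ≡ r₀ ++ r → r ≢ [] → u ++ u ++ Y ≡ r ++ flatten Ds → length r + 19 ≤ length u → ⊥
no-long-square {Bs} {X} {Pre} {B} {Ds} {r₀} {r} {u} {Y} (sf , _) eBs eB eBr r≢[] eS long
  with levi-≤ r (flatten Ds) u (u ++ Y) (sym eS) (≤-trans (m≤m+n (length r) 19) long)
... | u₂ , refl , eDs = second-copy Ds eB eDs
  where
  19≤u₂ : 19 ≤ length u₂
  19≤u₂ = +-cancelˡ-≤ (length r) 19 (length u₂) (subst (length r + 19 ≤_) (length-++ r) long)
  second-copy : ∀ Ds → Bs ≡ Pre ++ B ∷ Ds → flatten Ds ≡ u₂ ++ (r ++ u₂) ++ Y → ⊥
  second-copy []        _  e   = r≢[] (++-conicalˡ r u₂ (++-conicalˡ (r ++ u₂) Y (++-conicalʳ u₂ _ (sym e))))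
  second-copy (D ∷ Ds₁) eB eDs with levi-≤ (prefix19 D) (drop 19 (word D) ++ flatten Ds₁) u₂ ((r ++ u₂) ++ Y)
                                   (trans (sym (++-assoc (prefix19 D) _ _))
                                          (trans (cong (_++ flatten Ds₁) (take++drop≡id 19 (word D))) eDs))
                                   (subst (_≤ length u₂) (sym (length-prefix19 D)) 19≤u₂)
  ... | e , u₂≡ , _ with synchronize Bs (X ++ r ++ u₂ ++ r) D (e ++ Y) eBs′
    where
    eBs′ : flatten Bs ≡ (X ++ r ++ u₂ ++ r) ++ prefix19 D ++ e ++ Y
    eBs′ = begin
      flatten Bs                                      ≡⟨ eBs ⟩
      X ++ (r ++ u₂) ++ (r ++ u₂) ++ Y                ≡⟨ solve (++-monoid Letter) ⟩
      (X ++ r ++ u₂ ++ r) ++ u₂ ++ Y                  ≡⟨ cong (λ w → (X ++ r ++ u₂ ++ r) ++ w ++ Y) u₂≡ ⟩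
      (X ++ r ++ u₂ ++ r) ++ (prefix19 D ++ e) ++ Y   ≡⟨ cong ((X ++ r ++ u₂ ++ r) ++_) (++-assoc (prefix19 D) e Y) ⟩
      (X ++ r ++ u₂ ++ r) ++ prefix19 D ++ e ++ Y     ∎
      where open ≡-Reasoning
  ... | Pre′ , Ds′ , eBs″ , eDs′ =
    no-realignment (subst (SquareFree ∘ map letter) eB sf) eBr r≢[]
      (realign word≢[] word-prefixFree (Pre ∷ʳ B) (D ∷ Ds₁) Pre′ Ds′ u₂ r Y
        (trans (∷ʳ-++ Pre B _) (trans (sym eB) eBs″))
        (trans eDs (trans (cong (u₂ ++_) (++-assoc r u₂ Y)) (cong (λ w → u₂ ++ r ++ w) Ds′≡)))
        (sym Ds′≡))
    where
    Ds′≡ : u₂ ++ Y ≡ flatten Ds′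
    Ds′≡ = trans (cong (_++ Y) u₂≡) (trans (++-assoc (prefix19 D) e Y) eDs′)

no-square-factor : ∀ Bs X u Y → Admissible Bs → u ≢ [] → flatten Bs ≡ X ++ u ++ u ++ Y → ⊥
no-square-factor Bs X u Y adm u≢[] e with suffixPosition Bs X (u ++ u ++ Y) e
... | atEnd e′ = u≢[] (++-conicalˡ u _ e′)
... | inBlock Pre B Ds r₀ r eB eBr r≢[] eS with length u <? length r + 19
...   | yes short = no-short-square {u = u} {Y = Y} adm eB eBr r≢[] (sym eS) u≢[] short
...   | no ¬short = no-long-square {X = X} {u = u} {Y = Y} adm e eB eBr r≢[] eS (≮⇒≥ ¬short)

flatten-squareFree : ∀ Bs → Admissible Bs → SquareFree (flatten Bs)
flatten-squareFree Bs adm (X , _ , Y , e , u , u≢[] , refl) =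
  no-square-factor Bs X u Y adm u≢[] (trans e (cong (X ++_) (++-assoc u u Y)))

-- Occurrences of q and q̄

occurrencesStartingIn : Word → Word → Word → ℕ
occurrencesStartingIn u []      y = 0
occurrencesStartingIn u (b ∷ x) y = (if isPrefix u (b ∷ x ++ y) then 1 else 0) + occurrencesStartingIn u x y

occurrences-++ : ∀ u x y → occurrences u (x ++ y) ≡ occurrencesStartingIn u x y + occurrences u y
occurrences-++ u []      y = refl
occurrences-++ u (b ∷ x) y rewrite occurrences-++ u x y =
  sym (+-assoc (if isPrefix u (b ∷ x ++ y) then 1 else 0) (occurrencesStartingIn u x y) (occurrences u y))

occurrencesStartingIn-++ : ∀ u x y z → length u ≤ length y →
                           occurrencesStartingIn u x (y ++ z) ≡ occurrencesStartingIn u x y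
occurrencesStartingIn-++ u []      y z _   = refl
occurrencesStartingIn-++ u (b ∷ x) y z u≤y =
  cong₂ _+_ (cong (λ c → if c then 1 else 0) first) (occurrencesStartingIn-++ u x y z u≤y)
  where
  first : isPrefix u (b ∷ x ++ y ++ z) ≡ isPrefix u (b ∷ x ++ y)
  first = trans (cong (isPrefix u) (sym (++-assoc (b ∷ x) y z)))
                (isPrefix-++-≤ u (b ∷ x ++ y) z (≤-trans u≤y (length-++-≤ʳ y {b ∷ x})))

markerCount : Block → ℕ
markerCount (hBlock _) = 0
markerCount pBlock     = 1

pCount : List Block → ℕ
pCount []       = 0
pCount (B ∷ Bs) = markerCount B + pCount Bs

endCountᵇ : Word → Block → Bool
endCountᵇ u B = occurrencesStartingIn u (word B) [] ≡ᵇ markerCount B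

pairCountᵇ : Word → Block → Block → Bool
pairCountᵇ u B B′ = occurrencesStartingIn u (word B) (word B′) ≡ᵇ markerCount B

module _ (u : Word) (u≤24 : length u ≤ 24) (endCount-check : allBlocks (endCountᵇ u) ≡ true)
         (pairCount-check : allBlocks (λ B → allBlocks (pairCountᵇ u B)) ≡ true)
  where

  endCount : ∀ B → occurrencesStartingIn u (word B) [] ≡ markerCount B
  endCount B = ≡ᵇ⇒≡ (occurrencesStartingIn u (word B) []) (markerCount B) (allBlocks-sound (endCountᵇ u) endCount-check B)

  pairCount : ∀ B B′ → occurrencesStartingIn u (word B) (word B′) ≡ markerCount B
  pairCount B B′ = ≡ᵇ⇒≡ (occurrencesStartingIn u (word B) (word B′)) (markerCount B)
                        (allBlocks²-sound (pairCountᵇ u) pairCount-check B B′)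

  occurrences-flatten : ∀ Bs → occurrences u (flatten Bs) ≡ pCount Bs
  occurrences-flatten []           = refl
  occurrences-flatten (B ∷ [])     = begin
    occurrences u (word B ++ [])            ≡⟨ occurrences-++ u (word B) [] ⟩
    occurrencesStartingIn u (word B) [] + 0 ≡⟨ cong (_+ 0) (endCount B) ⟩
    markerCount B + 0                       ∎
    where open ≡-Reasoning
  occurrences-flatten (B ∷ B′ ∷ Bs) = begin
    occurrences u (word B ++ word B′ ++ flatten Bs)
      ≡⟨ occurrences-++ u (word B) _ ⟩
    occurrencesStartingIn u (word B) (word B′ ++ flatten Bs) + occurrences u (flatten (B′ ∷ Bs))
      ≡⟨ cong₂ _+_ (occurrencesStartingIn-++ u (word B) (word B′) (flatten Bs) (≤-trans u≤24 (24≤length-word B′)))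
                   (occurrences-flatten (B′ ∷ Bs)) ⟩
    occurrencesStartingIn u (word B) (word B′) + pCount (B′ ∷ Bs)
      ≡⟨ cong (_+ pCount (B′ ∷ Bs)) (pairCount B B′) ⟩
    markerCount B + pCount (B′ ∷ Bs) ∎
    where open ≡-Reasoning

hBlocks : ∀ {x v} → InH x v → List Block
hBlocks []      = []
hBlocks (h ∷ d) = hBlock h ∷ hBlocks d

framed : ∀ {x v} → InH x v → List Block
framed d = pBlock ∷ hBlocks d ++ pBlock ∷ []

flatten-hBlocks : ∀ {x v} (d : InH x v) → flatten (hBlocks d) ≡ v
flatten-hBlocks []      = refl
flatten-hBlocks (h ∷ d) = cong (_ ++_) (flatten-hBlocks d)

letters-hBlocks : ∀ {x v} (d : InH x v) → map letter (hBlocks d) ≡ x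
letters-hBlocks []      = refl
letters-hBlocks (h ∷ d) = cong (_ ∷_) (letters-hBlocks d)

flatten-framed : ∀ {x v} (d : InH x v) → flatten (framed d) ≡ p ++ v ++ p
flatten-framed d =
  cong (p ++_) (trans (concatMap-++ word (hBlocks d) (pBlock ∷ [])) (cong₂ _++_ (flatten-hBlocks d) (++-identityʳ p)))

letters-framed : ∀ {w v} (d : InH (c0 ∷ w ++ c0 ∷ []) v) → map letter (framed d) ≡ c1 ∷ c0 ∷ w ++ c0 ∷ c1 ∷ []
letters-framed {w} d =
  cong (c1 ∷_) (trans (map-++ letter (hBlocks d) (pBlock ∷ []))
                      (trans (cong (_++ c1 ∷ []) (letters-hBlocks d)) (cong (c0 ∷_) (++-assoc w (c0 ∷ []) (c1 ∷ [])))))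

pCount-framed : ∀ {x v} (d : InH x v) → pCount (framed d) ≡ 2
pCount-framed d = cong (1 +_) (last-p d)
  where
  last-p : ∀ {x v} (d : InH x v) → pCount (hBlocks d ++ pBlock ∷ []) ≡ 1
  last-p []      = refl
  last-p (h ∷ d) = last-p d

linked-before-p : ∀ {x v} y (d : InH x v) → x ≡ y ∷ʳ c0 → Linked Adjacent (hBlocks d ++ pBlock ∷ [])
linked-before-p y       []                e = case ++-conicalʳ y (c0 ∷ []) (sym e) of λ ()
linked-before-p y       (h ∷ [])          e = subst (λ a → T (a =? c0)) (sym (∷ʳ-injectiveʳ [] y e)) tt Linked.∷ [-]
linked-before-p []      (h ∷ (h′ ∷ d))    ()
linked-before-p (_ ∷ y) (h ∷ d@(_ ∷ _))   e = tt Linked.∷ linked-before-p y d (∷-injectiveʳ e)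

framed-linked : ∀ {w v} (d : InH (c0 ∷ w ++ c0 ∷ []) v) → Linked Adjacent (framed d)
framed-linked {w} (h ∷ d) = tt Linked.∷ linked-before-p (c0 ∷ w) (h ∷ d) refl

lemma5 : (w : Word) → 4 ≤ length w
       → SquareFree (c1 ∷ c0 ∷ w ++ c0 ∷ c1 ∷ [])
       → ∀ v → InH (c0 ∷ w ++ c0 ∷ []) v → Nice v
lemma5 w _ sf v d = subst SquareFree framed≡ squareFree , subst (λ z → occurrences q z ≡ 2) framed≡ q-count
                                                        , subst (λ z → occurrences qbar z ≡ 2) framed≡ qbar-count
  where
  framed≡ = flatten-framed d
  squareFree = flatten-squareFree (framed d) (subst SquareFree (sym (letters-framed d)) sf , framed-linked d)
  q-count = trans (occurrences-flatten q (≤ᵇ⇒≤ 19 24 tt) refl refl (framed d)) (pCount-framed d)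
  qbar-count = trans (occurrences-flatten qbar (≤ᵇ⇒≤ 19 24 tt) refl refl (framed d)) (pCount-framed d)
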